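{- Let $G$ be a connected graph and let $H$ be a subgraph of $G$ that is a weak retract of $G$. If $\rho(H) > \rho$ for an integer $\rho \ge 0$, then $\rho(G) > \rho$.
   Context: Patrol game with radius of capture $\rho\ge 0$ on a connected graph $G$: there is one cop and one robber. Before the game the cop fixes a walk in $G$ (his patrol: a sequence of vertices in which consecutive vertices are equal or adjacent), and the robber knows the entire patrol in advance, while the cop has no information about the robber. The cop starts at the first vertex of his patrol, then the robber chooses a starting vertex; afterwards the players alternate moves (cop first), the cop following his patrol and the robber moving to an adjacent vertex or staying put. The cop wins (captures the robber) if at some moment the distance in $G$ between the cop and the robber is at most $\rho$; otherwise the robber wins. $\rho(G)$ denotes the minimum $\rho\ge 0$ such that the cop has a patrol that captures the robber regardless of how the robber plays. A weak homomorphism from $G$ to $H$ is a map $\varphi:V(G)\to V(H)$ such that adjacent vertices of $G$ are mapped to equal or adjacent vertices of $H$. A subgraph $H$ of $G$ is a weak retract of $G$ if there is a weak homomorphism $\varphi:V(G)\to V(H)$ with $\varphi(u)=u$ for all $u\in V(H)$. -}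

module Defs where

open import Data.Nat using (ℕ; zero; suc; _≤_)
open import Data.Fin using (Fin; zero; suc; inject₁)
open import Data.Product using (Σ; ∃; ∃-syntax; _×_; _,_)
open import Data.Sum using (_⊎_)
open import Relation.Nullary using (¬_)
open import Relation.Binary.PropositionalEquality using (_≡_)
open import Function.Definitions using (Injective)

record Graph (n : ℕ) : Set₁ where
  field
    Adj    : Fin n → Fin n → Set
    sym    : ∀ {u v} → Adj u v → Adj v u
    irrefl : ∀ {u} → ¬ Adj u u
open Graph public

module _ {n : ℕ} (G : Graph n) where

  -- Reach k u v : there is a walk from u to v of length at most k,
  -- i.e. dist_G(u, v) ≤ k.
  data Reach : ℕ → Fin n → Fin n → Set where
    here : ∀ {k u} → Reach k u u
    step : ∀ {k u w v} → Adj G u w → Reach k w v → Reach (suc k) u v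

  Connected : Set
  Connected = ∀ u v → ∃[ k ] Reach k u v

  Step : Fin n → Fin n → Set
  Step u v = u ≡ v ⊎ Adj G u v

  IsWalk : (L : ℕ) → (Fin (suc L) → Fin n) → Set
  IsWalk L w = ∀ (i : Fin L) → Step (w (inject₁ i)) (w (suc i))

  record Patrol : Set where
    field
      len  : ℕ
      pos  : Fin (suc len) → Fin n
      walk : IsWalk len pos
  open Patrol public

  -- At time 0 cop is at c 0, robber picks r 0.
  -- Then cop moves to c (i+1), robber moves to r (i+1), etc.
  -- Capture happens if at some moment dist(cop, robber) ≤ ρ:
  -- either after the robber's i-th placement/move (cop at c i, robber at r i)
  -- or after the cop's (i+1)-th move (cop at c (i+1), robber at r i).
  -- Since the robber knows the patrol in advance, a robber strategy is a walk.
  Captures : ℕ → (P : Patrol) → (Fin (suc (len P)) → Fin n) → Set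
  Captures ρ P r =
    (∃[ i ] Reach ρ (pos P i) (r i))
    ⊎ (∃[ i ] Reach ρ (pos P (suc i)) (r (inject₁ i)))

  CopWins : ℕ → Set
  CopWins ρ = ∃[ P ] (∀ (r : Fin (suc (len P)) → Fin n) →
                        IsWalk (len P) r → Captures ρ P r)

  -- ρ(G) > ρ, where ρ(G) = min { r | CopWins r }:
  -- no radius r ≤ ρ lets the cop win.
  RadiusExceeds : ℕ → Set
  RadiusExceeds ρ = ∀ r → r ≤ ρ → ¬ CopWins r

record Subgraph {m n : ℕ} (H : Graph m) (G : Graph n) : Set where
  field
    ι      : Fin m → Fin n
    ι-inj  : Injective _≡_ _≡_ ι
    ι-adj  : ∀ {u v} → Adj H u v → Adj G (ι u) (ι v)
open Subgraph public

IsWeakHom : {n m : ℕ} (G : Graph n) (H : Graph m) → (Fin n → Fin m) → Set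
IsWeakHom G H φ = ∀ {u v} → Adj G u v → φ u ≡ φ v ⊎ Adj H (φ u) (φ v)

WeakRetract : {m n : ℕ} (H : Graph m) (G : Graph n) → Subgraph H G → Set
WeakRetract H G S =
  Σ (Fin _ → Fin _) λ φ → IsWeakHom G H φ × (∀ u → φ (ι S u) ≡ u)

{-# OPTIONS --safe #-}
-- A weak homomorphism maps walks to walks and does not increase distances.
-- So a winning patrol in G, pushed forward along the retraction φ : G → H,
-- is a winning patrol in H: a robber walking in H is also a robber walking
-- in G, caught there within distance ρ, and applying φ, which fixes H,
-- turns this into a capture in H.
module Submission where

open import Defs
open import Data.Nat using (ℕ; suc)
open import Data.Fin using (Fin)
open import Data.Product using (_,_)
open import Data.Sum using (inj₁; inj₂)
open import Function using (_∘_; id)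
open import Relation.Binary.PropositionalEquality as ≡ using (_≗_; cong; subst)

Reach-suc : ∀ {n} {G : Graph n} {k u v} → Reach G k u v → Reach G (suc k) u v
Reach-suc here         = here
Reach-suc (step adj r) = step adj (Reach-suc r)

ι-isWeakHom : ∀ {m n} {H : Graph m} {G : Graph n} (S : Subgraph H G) →
  IsWeakHom H G (ι S)
ι-isWeakHom S = inj₂ ∘ ι-adj S

module _ {n m} {G : Graph n} {H : Graph m} {φ : Fin n → Fin m}
         (φ-hom : IsWeakHom G H φ) where

  Step-map : ∀ {u v} → Step G u v → Step H (φ u) (φ v)
  Step-map (inj₁ u≡v) = inj₁ (cong φ u≡v)
  Step-map (inj₂ adj) = φ-hom adj

  IsWalk-map : ∀ {L} w → IsWalk G L w → IsWalk H L (φ ∘ w)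
  IsWalk-map w w-walk i = Step-map (w-walk i)

  Reach-map : ∀ {k u v} → Reach G k u v → Reach H k (φ u) (φ v)
  Reach-map here = here
  Reach-map (step {v = v} adj r) with φ-hom adj
  ... | inj₁ φu≡φw = subst (λ x → Reach H _ x (φ v)) (≡.sym φu≡φw) (Reach-suc (Reach-map r))
  ... | inj₂ adj′  = step adj′ (Reach-map r)

  Patrol-map : Patrol G → Patrol H
  Patrol-map P = record { len = len P ; pos = φ ∘ pos P ; walk = IsWalk-map (pos P) (walk P) }

  Captures-map : ∀ {ρ} (P : Patrol G) {r} →
    Captures G ρ P r → Captures H ρ (Patrol-map P) (φ ∘ r)
  Captures-map P (inj₁ (i , R)) = inj₁ (i , Reach-map R)
  Captures-map P (inj₂ (i , R)) = inj₂ (i , Reach-map R)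

Captures-resp-≗ : ∀ {n} {G : Graph n} {ρ} (P : Patrol G) {r r′} →
  r ≗ r′ → Captures G ρ P r → Captures G ρ P r′
Captures-resp-≗ {G = G} P r≗r′ (inj₁ (i , R)) = inj₁ (i , subst (Reach G _ _) (r≗r′ i) R)
Captures-resp-≗ {G = G} P r≗r′ (inj₂ (i , R)) = inj₂ (i , subst (Reach G _ _) (r≗r′ _) R)

CopWins-retract : ∀ {n m} {G : Graph n} {H : Graph m}
  {φ : Fin n → Fin m} {ψ : Fin m → Fin n} →
  IsWeakHom G H φ → IsWeakHom H G ψ → φ ∘ ψ ≗ id →
  ∀ {ρ} → CopWins G ρ → CopWins H ρ
CopWins-retract {G = G} {H} {ψ = ψ} φ-hom ψ-hom φ∘ψ≗id (P , catches) =
  Patrol-map φ-hom P , λ r r-walk →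
    Captures-resp-≗ (Patrol-map φ-hom P) (φ∘ψ≗id ∘ r)
      (Captures-map φ-hom P (catches (ψ ∘ r) (IsWalk-map {G = H} {G} ψ-hom r r-walk)))

theorem1 : ∀ {n m : ℕ} (G : Graph n) (H : Graph m) (S : Subgraph H G) →
    Connected G → WeakRetract H G S → (ρ : ℕ) →
    RadiusExceeds H ρ → RadiusExceeds G ρ
theorem1 G H S _ (φ , φ-hom , φ∘ι≗id) ρ H-exceeds r r≤ρ G-wins =
  H-exceeds r r≤ρ (CopWins-retract φ-hom (ι-isWeakHom S) φ∘ι≗id G-wins)
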